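{- Let $p$ be an odd prime, $r\ge3$ an integer with $p\nmid r$, $D=\mathrm{D}_{2r}$, and let $G=V\rtimes_\psi D$ with $V=\mathbb{Z}_p^d$ and $\psi$ irreducible and non-trivial. Let $A=\mathrm{Aut}(G)$, $N=\mathrm{N}_A(D)$, and define the homomorphism $\kappa:N\to\mathrm{Aut}(D)$, $f\mapsto f|_D$. Then $\ker(\kappa)\cong\mathrm{End}_D(V)^\times$ and $\mathrm{im}(\kappa)=\mathrm{Aut}(D)_\psi$, where $\mathrm{Aut}(D)_\psi=\{\sigma\in\mathrm{Aut}(D):\psi\circ\sigma\cong\psi\}$.
   Context: $\mathrm{D}_{2r}$ is the dihedral group of order $2r$; $\psi:D\to\mathrm{GL}_d(\mathbb{F}_p)$ defines the action of $D$ on $V=\mathbb{F}_p^d$. $\mathrm{N}_A(D)=\{f\in A: f(D)=D\}$. $\mathrm{End}_D(V)^\times$ is the group of invertible $D$-module endomorphisms of $V$. -}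

module Defs where

open import Data.Nat using (ℕ; zero; suc; NonZero; _+_; _*_; _∸_; _≤_)
open import Data.Nat.DivMod using (_mod_)
open import Data.Fin using (Fin; toℕ)
import Data.Fin as F
open import Data.Bool using (Bool; true; false; _xor_; if_then_else_)
open import Data.Vec using (Vec; zipWith; replicate; map; foldr′; lookup; tabulate)
open import Data.Product using (Σ; ∃; _×_; _,_; proj₁; proj₂)
open import Data.Sum using (_⊎_)
open import Relation.Binary.PropositionalEquality using (_≡_)
open import Relation.Nullary using (¬_; does)

module _ (p : ℕ) .{{_ : NonZero p}} where

  Fp : Set
  Fp = Fin p

  f0 f1 : Fp
  f0 = 0 mod p
  f1 = 1 mod p

  fadd fmul : Fp → Fp → Fp
  fadd a b = (toℕ a + toℕ b) mod p
  fmul a b = (toℕ a * toℕ b) mod p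

module _ (p d : ℕ) .{{_ : NonZero p}} where

  V : Set
  V = Vec (Fp p) d

  vzero : V
  vzero = replicate d (f0 p)

  vadd : V → V → V
  vadd = zipWith (fadd p)

  smul : Fp p → V → V
  smul c = map (fmul p c)

  Mat : Set
  Mat = Vec (Vec (Fp p) d) d

  dot : Vec (Fp p) d → Vec (Fp p) d → Fp p
  dot u v = foldr′ (fadd p) (f0 p) (zipWith (fmul p) u v)

  mapply : Mat → V → V
  mapply M v = map (λ row → dot row v) M

  mmul : Mat → Mat → Mat
  mmul M N = tabulate λ i → tabulate λ j → dot (lookup M i) (map (λ row → lookup row j) N)

  idMat : Mat
  idMat = tabulate λ i → tabulate λ j → if does (i F.≟ j) then f1 p else f0 p

-- The dihedral group D_{2r}: the pair (k , e) stands for ρ^k τ^e,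
-- where ρ^r = τ^2 = 1 and τ ρ τ⁻¹ = ρ⁻¹.

module _ (r : ℕ) .{{_ : NonZero r}} where

  zadd : Fin r → Fin r → Fin r
  zadd a b = (toℕ a + toℕ b) mod r

  zneg : Fin r → Fin r
  zneg a = (r ∸ toℕ a) mod r

  Dih : Set
  Dih = Fin r × Bool

  dunit : Dih
  dunit = (0 mod r , false)

  dmul : Dih → Dih → Dih
  dmul (k₁ , e₁) (k₂ , e₂) = (zadd k₁ (if e₁ then zneg k₂ else k₂) , e₁ xor e₂)

record IsAut {A : Set} (_·_ : A → A → A) (f : A → A) : Set where
  field
    inv   : A → A
    invˡ  : ∀ a → inv (f a) ≡ a
    invʳ  : ∀ a → f (inv a) ≡ a
    hom   : ∀ a b → f (a · b) ≡ (f a · f b)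

module _ (p d r : ℕ) .{{_ : NonZero p}} .{{_ : NonZero r}} where

  Rep : Set
  Rep = Dih r → Mat p d

  IsRep : Rep → Set
  IsRep ψ = (ψ (dunit r) ≡ idMat p d)
          × (∀ x y → ψ (dmul r x y) ≡ mmul p d (ψ x) (ψ y))

  NonTrivial : Rep → Set
  NonTrivial ψ = ∃ λ x → ¬ (ψ x ≡ idMat p d)

  IsSubspace : (V p d → Bool) → Set
  IsSubspace W = (W (vzero p d) ≡ true)
               × (∀ v w → W v ≡ true → W w ≡ true → W (vadd p d v w) ≡ true)
               × (∀ c v → W v ≡ true → W (smul p d c v) ≡ true)

  IsInvariant : Rep → (V p d → Bool) → Set
  IsInvariant ψ W = ∀ x v → W v ≡ true → W (mapply p d (ψ x) v) ≡ true

  IsIrreducible : Rep → Set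
  IsIrreducible ψ = (1 ≤ d)
    × (∀ W → IsSubspace W → IsInvariant ψ W →
         (∀ v → W v ≡ true → v ≡ vzero p d) ⊎ (∀ v → W v ≡ true))

  G : Set
  G = V p d × Dih r

  gmul : Rep → G → G → G
  gmul ψ (v , x) (w , y) = (vadd p d v (mapply p d (ψ x) w) , dmul r x y)

  incD : Dih r → G
  incD x = (vzero p d , x)

  InN : (G → G) → Set
  InN f = (∀ x → proj₁ (f (incD x)) ≡ vzero p d)
        × (∀ y → ∃ λ x → f (incD x) ≡ incD y)

  κ : (G → G) → Dih r → Dih r
  κ f x = proj₂ (f (incD x))

  KerEl : Rep → Set
  KerEl ψ = Σ (G → G) λ f → IsAut (gmul ψ) f × InN f × (∀ x → κ f x ≡ x)

  Invertible : Mat p d → Set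
  Invertible T = ∃ λ (U : Mat p d) → (mmul p d T U ≡ idMat p d) × (mmul p d U T ≡ idMat p d)

  UnitEl : Rep → Set
  UnitEl ψ = Σ (Mat p d) λ T → Invertible T
           × (∀ x → mmul p d T (ψ x) ≡ mmul p d (ψ x) T)

  -- group isomorphism ker κ ≅ End_D(V)^×  (ker κ under composition with
  -- pointwise equality of maps; End_D(V)^× under matrix multiplication)
  record KerIsoUnits (ψ : Rep) : Set where
    field
      Φ    : KerEl ψ → UnitEl ψ
      resp : ∀ k k' → (∀ a → proj₁ k a ≡ proj₁ k' a) → proj₁ (Φ k) ≡ proj₁ (Φ k')
      inj  : ∀ k k' → proj₁ (Φ k) ≡ proj₁ (Φ k') → ∀ a → proj₁ k a ≡ proj₁ k' a
      surj : ∀ (u : UnitEl ψ) → ∃ λ (k : KerEl ψ) → proj₁ (Φ k) ≡ proj₁ u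
      hom  : ∀ k₁ k₂ k₃ → (∀ a → proj₁ k₃ a ≡ proj₁ k₁ (proj₁ k₂ a)) →
             proj₁ (Φ k₃) ≡ mmul p d (proj₁ (Φ k₁)) (proj₁ (Φ k₂))

  RepIso : Rep → Rep → Set
  RepIso φ ψ = ∃ λ (T : Mat p d) → Invertible T × (∀ x → mmul p d T (φ x) ≡ mmul p d (ψ x) T)

  ImageIsStabiliser : Rep → Set
  ImageIsStabiliser ψ =
      (∀ f → IsAut (gmul ψ) f → InN f → RepIso (λ x → ψ (κ f x)) ψ)
    × (∀ σ → IsAut (dmul r) σ → RepIso (λ x → ψ (σ x)) ψ →
         ∃ λ f → IsAut (gmul ψ) f × InN f × (∀ x → κ f x ≡ σ x))

-- An automorphism f of G = V ⋊ D sends V into V: an element of V has order p, and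
-- the dihedral group has no elements of order p when p is odd and prime to r.  So
-- if f also preserves D, then f(v , x) = (T v , σ x) with T additive, hence linear
-- over F_p, and compatibility with the action reads T ψ(x) = ψ(σ x) T.  Conversely
-- any such pair (T , σ) with T invertible defines an element of N_A(D).  Taking
-- σ = id identifies ker κ with End_D(V)^×, and in general T⁻¹ witnesses ψ ∘ σ ≅ ψ.

module Submission where

open import Defs
open import Data.Nat using (ℕ; zero; suc; NonZero; _+_; _*_; _∸_; _%_; _≤_)
import Data.Nat.Properties as ℕ
open import Data.Nat.DivMod using (_mod_; %-distribˡ-+; %-distribˡ-*; m%n%n≡m%n; m%n<n; m*n%n≡0; n%n≡0; m<n⇒m%n≡m)
open import Data.Nat.Divisibility using (_∣_; divides; ∣-refl; ∣m∣n⇒∣m+n; n∣m⇒m%n≡0; m%n≡0⇒n∣m)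
open import Data.Nat.Primality using (Prime; prime⇒irreducible)
open import Data.Nat.Coprimality using (Coprime; coprime-divisor)
import Data.Nat.Coprimality as Coprime
open import Data.Fin using (Fin; toℕ; _≟_) renaming (zero to fzero; suc to fsuc)
open import Data.Fin.Properties using (toℕ-injective; toℕ-fromℕ<; toℕ<n)
open import Data.Bool using (true; false; not; _xor_; if_then_else_)
open import Data.Vec using (Vec; []; _∷_; map; lookup; tabulate)
open import Data.Vec.Properties using (lookup-map; lookup∘tabulate; tabulate∘lookup; tabulate-cong; map-cong; map-const; lookup-replicate; lookup-zipWith; zipWith-identityˡ; zipWith-identityʳ)
open import Data.Product using (∃; _×_; _,_; proj₁; proj₂)
open import Data.Sum using (inj₁; inj₂)
open import Data.Empty using (⊥-elim)
open import Function using (_∘_; id)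
open import Relation.Nullary using (¬_; does)
open import Relation.Binary.PropositionalEquality
open import Relation.Binary.PropositionalEquality.Algebra using (isMagma)
open import Algebra.Bundles using (CommutativeSemigroup)
import Algebra.Properties.CommutativeSemigroup as CommutativeSemigroupProperties

open ≡-Reasoning

private variable
  A B : Set
  d m : ℕ

module _ (_·_ : A → A → A) (ε : A) where

  power : ℕ → A → A
  power zero    a = ε
  power (suc n) a = a · power n a

power-homomorphic : {_·_ : A → A → A} {ε : A} {_∙_ : B → B → B} {ε′ : B} (h : A → B) →
                    h ε ≡ ε′ → (∀ a b → h (a · b) ≡ h a ∙ h b) →
                    ∀ n a → h (power _·_ ε n a) ≡ power _∙_ ε′ n (h a)
power-homomorphic h h-ε h-· zero    a = h-ε
power-homomorphic {_∙_ = _∙_} h h-ε h-· (suc n) a =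
  trans (h-· a _) (cong (h a ∙_) (power-homomorphic h h-ε h-· n a))

id-isAut : {_·_ : A → A → A} → IsAut _·_ id
id-isAut = record { inv = id ; invˡ = λ _ → refl ; invʳ = λ _ → refl ; hom = λ _ _ → refl }

module _ {_·_ : A → A → A} {f : A → A} (f-aut : IsAut _·_ f) where
  open IsAut f-aut

  inv-isAut : IsAut _·_ inv
  inv-isAut = record
    { inv  = f
    ; invˡ = invʳ
    ; invʳ = invˡ
    ; hom  = λ a b → begin
        inv (a · b)                 ≡⟨ cong inv (cong₂ _·_ (invʳ a) (invʳ b)) ⟨
        inv (f (inv a) · f (inv b)) ≡⟨ cong inv (hom _ _) ⟨
        inv (f (inv a · inv b))     ≡⟨ invˡ _ ⟩
        inv a · inv b               ∎
    }

  isAut-identity : ∀ {ε} → (∀ a → ε · a ≡ a) → (∀ a → a · ε ≡ a) → f ε ≡ ε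
  isAut-identity {ε} identityˡ identityʳ = begin
    f ε                ≡⟨ identityʳ (f ε) ⟨
    f ε · ε            ≡⟨ cong (f ε ·_) (invʳ ε) ⟨
    f ε · f (inv ε)    ≡⟨ hom ε (inv ε) ⟨
    f (ε · inv ε)      ≡⟨ cong f (identityˡ (inv ε)) ⟩
    f (inv ε)          ≡⟨ invʳ ε ⟩
    ε                  ∎

odd⇒1+2q : ∀ n → ¬ 2 ∣ n → ∃ λ q → n ≡ 1 + q * 2
odd⇒1+2q zero          2∤0 = ⊥-elim (2∤0 (divides 0 refl))
odd⇒1+2q (suc zero)    _   = 0 , refl
odd⇒1+2q (suc (suc n)) 2∤n+2 with odd⇒1+2q n (2∤n+2 ∘ ∣m∣n⇒∣m+n ∣-refl)
... | q , n≡1+2q = suc q , cong (2 +_) n≡1+2q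

prime∤⇒coprime : ∀ {p n} → Prime p → ¬ p ∣ n → Coprime p n
prime∤⇒coprime p-prime p∤n (k∣p , k∣n) with prime⇒irreducible p-prime k∣p
... | inj₁ k≡1 = k≡1
... | inj₂ refl = ⊥-elim (p∤n k∣n)

module Modular (n : ℕ) .{{_ : NonZero n}} where

  infixl 6 _+ₘ_
  infixl 7 _*ₘ_

  _+ₘ_ _*ₘ_ : Fin n → Fin n → Fin n
  _+ₘ_ = fadd n
  _*ₘ_ = fmul n

  0ₘ 1ₘ : Fin n
  0ₘ = f0 n
  1ₘ = f1 n

  toℕ-mod : ∀ x → toℕ (x mod n) ≡ x % n
  toℕ-mod x = toℕ-fromℕ< (m%n<n x n)

  toℕ-mod-% : ∀ x → toℕ (x mod n) % n ≡ x % n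
  toℕ-mod-% x = trans (cong (_% n) (toℕ-mod x)) (m%n%n≡m%n x n)

  toℕ-0ₘ : toℕ 0ₘ ≡ 0
  toℕ-0ₘ = trans (toℕ-mod 0) (m*n%n≡0 0 n)

  mod-toℕ : ∀ a → toℕ a mod n ≡ a
  mod-toℕ a = toℕ-injective (trans (toℕ-mod (toℕ a)) (m<n⇒m%n≡m (toℕ<n a)))

  mod-cong : ∀ {x y} → x % n ≡ y % n → x mod n ≡ y mod n
  mod-cong {x} {y} eq = toℕ-injective (trans (toℕ-mod x) (trans eq (sym (toℕ-mod y))))

  %-cong-+ : ∀ {x x′ y y′} → x % n ≡ x′ % n → y % n ≡ y′ % n → (x + y) % n ≡ (x′ + y′) % n
  %-cong-+ {x} {x′} {y} {y′} eqx eqy = begin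
    (x + y) % n             ≡⟨ %-distribˡ-+ x y n ⟩
    (x % n + y % n) % n     ≡⟨ cong₂ (λ a b → (a + b) % n) eqx eqy ⟩
    (x′ % n + y′ % n) % n   ≡⟨ %-distribˡ-+ x′ y′ n ⟨
    (x′ + y′) % n           ∎

  %-cong-* : ∀ {x x′ y y′} → x % n ≡ x′ % n → y % n ≡ y′ % n → (x * y) % n ≡ (x′ * y′) % n
  %-cong-* {x} {x′} {y} {y′} eqx eqy = begin
    (x * y) % n             ≡⟨ %-distribˡ-* x y n ⟩
    (x % n * (y % n)) % n   ≡⟨ cong₂ (λ a b → (a * b) % n) eqx eqy ⟩
    (x′ % n * (y′ % n)) % n ≡⟨ %-distribˡ-* x′ y′ n ⟨
    (x′ * y′) % n           ∎

  +ₘ-comm : ∀ a b → a +ₘ b ≡ b +ₘ a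
  +ₘ-comm a b = cong (_mod n) (ℕ.+-comm (toℕ a) (toℕ b))

  +ₘ-assoc : ∀ a b c → a +ₘ b +ₘ c ≡ a +ₘ (b +ₘ c)
  +ₘ-assoc a b c = mod-cong (begin
    (toℕ (a +ₘ b) + toℕ c) % n     ≡⟨ %-cong-+ (toℕ-mod-% _) refl ⟩
    (toℕ a + toℕ b + toℕ c) % n    ≡⟨ cong (_% n) (ℕ.+-assoc (toℕ a) (toℕ b) (toℕ c)) ⟩
    (toℕ a + (toℕ b + toℕ c)) % n  ≡⟨ %-cong-+ refl (toℕ-mod-% _) ⟨
    (toℕ a + toℕ (b +ₘ c)) % n     ∎)

  +ₘ-identityʳ : ∀ a → a +ₘ 0ₘ ≡ a
  +ₘ-identityʳ a = begin
    (toℕ a + toℕ 0ₘ) mod n  ≡⟨ cong (λ z → (toℕ a + z) mod n) toℕ-0ₘ ⟩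
    (toℕ a + 0) mod n       ≡⟨ cong (_mod n) (ℕ.+-identityʳ (toℕ a)) ⟩
    toℕ a mod n             ≡⟨ mod-toℕ a ⟩
    a                       ∎

  +ₘ-identityˡ : ∀ a → 0ₘ +ₘ a ≡ a
  +ₘ-identityˡ a = trans (+ₘ-comm 0ₘ a) (+ₘ-identityʳ a)

  *ₘ-zeroʳ : ∀ a → a *ₘ 0ₘ ≡ 0ₘ
  *ₘ-zeroʳ a = trans (cong (λ z → (toℕ a * z) mod n) toℕ-0ₘ) (cong (_mod n) (ℕ.*-zeroʳ (toℕ a)))

  *ₘ-identityʳ : ∀ a → a *ₘ 1ₘ ≡ a
  *ₘ-identityʳ a = begin
    (toℕ a * toℕ 1ₘ) mod n  ≡⟨ mod-cong (%-cong-* {x = toℕ a} refl (toℕ-mod-% 1)) ⟩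
    (toℕ a * 1) mod n       ≡⟨ cong (_mod n) (ℕ.*-identityʳ (toℕ a)) ⟩
    toℕ a mod n             ≡⟨ mod-toℕ a ⟩
    a                       ∎

  *ₘ-distribˡ-+ₘ : ∀ a b c → a *ₘ (b +ₘ c) ≡ a *ₘ b +ₘ a *ₘ c
  *ₘ-distribˡ-+ₘ a b c = mod-cong (begin
    (toℕ a * toℕ (b +ₘ c)) % n           ≡⟨ %-cong-* {x = toℕ a} refl (toℕ-mod-% _) ⟩
    (toℕ a * (toℕ b + toℕ c)) % n        ≡⟨ cong (_% n) (ℕ.*-distribˡ-+ (toℕ a) (toℕ b) (toℕ c)) ⟩
    (toℕ a * toℕ b + toℕ a * toℕ c) % n  ≡⟨ %-cong-+ (toℕ-mod-% _) (toℕ-mod-% _) ⟨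
    (toℕ (a *ₘ b) + toℕ (a *ₘ c)) % n    ∎)

  +ₘ-commutativeSemigroup : CommutativeSemigroup _ _
  +ₘ-commutativeSemigroup = record
    { Carrier = Fin n
    ; _≈_ = _≡_
    ; _∙_ = _+ₘ_
    ; isCommutativeSemigroup = record
      { isSemigroup = record { isMagma = isMagma _+ₘ_ ; assoc = +ₘ-assoc }
      ; comm = +ₘ-comm
      }
    }

  open CommutativeSemigroupProperties +ₘ-commutativeSemigroup public
    using () renaming (interchange to +ₘ-interchange)

  mod-+ₘ-1ₘ : ∀ x → x mod n +ₘ 1ₘ ≡ suc x mod n
  mod-+ₘ-1ₘ x = mod-cong (trans (%-cong-+ (toℕ-mod-% x) (toℕ-mod-% 1)) (cong (_% n) (ℕ.+-comm x 1)))

  power-+ₘ : ∀ k a → power _+ₘ_ 0ₘ k a ≡ (k * toℕ a) mod n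
  power-+ₘ zero    a = refl
  power-+ₘ (suc k) a = trans (cong (a +ₘ_) (power-+ₘ k a)) (mod-cong (%-cong-+ refl (toℕ-mod-% (k * toℕ a))))

  power-+ₘ-n : ∀ a → power _+ₘ_ 0ₘ n a ≡ 0ₘ
  power-+ₘ-n a = trans (power-+ₘ n a) (mod-cong (begin
    (n * toℕ a) % n  ≡⟨ cong (_% n) (ℕ.*-comm n (toℕ a)) ⟩
    (toℕ a * n) % n  ≡⟨ m*n%n≡0 (toℕ a) n ⟩
    0                ≡⟨ m*n%n≡0 0 n ⟨
    0 % n            ∎))

  power-+ₘ-coprime : Coprime n m → ∀ a → power _+ₘ_ 0ₘ m a ≡ 0ₘ → a ≡ 0ₘ
  power-+ₘ-coprime {m} n⊥m a ma≡0 = toℕ-injective (begin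
    toℕ a      ≡⟨ m<n⇒m%n≡m (toℕ<n a) ⟨
    toℕ a % n  ≡⟨ n∣m⇒m%n≡0 (toℕ a) n (coprime-divisor n⊥m (m%n≡0⇒n∣m (m * toℕ a) n ma%n≡0)) ⟩
    0          ≡⟨ toℕ-0ₘ ⟨
    toℕ 0ₘ     ∎)
    where
    ma%n≡0 : (m * toℕ a) % n ≡ 0
    ma%n≡0 = begin
      (m * toℕ a) % n           ≡⟨ toℕ-mod (m * toℕ a) ⟨
      toℕ ((m * toℕ a) mod n)   ≡⟨ cong toℕ (trans (sym (power-+ₘ m a)) ma≡0) ⟩
      toℕ 0ₘ                    ≡⟨ toℕ-0ₘ ⟩
      0                         ∎

lookup-ext : {v w : Vec A m} → (∀ i → lookup v i ≡ lookup w i) → v ≡ w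
lookup-ext {v = v} {w} eq = trans (sym (tabulate∘lookup v)) (trans (tabulate-cong eq) (tabulate∘lookup w))

module LinearAlgebra (p : ℕ) .{{_ : NonZero p}} where
  open Modular p

  basis : Fin d → V p d
  basis {suc d} fzero    = 1ₘ ∷ vzero p d
  basis {suc d} (fsuc j) = 0ₘ ∷ basis j

  column : Fin d → Mat p d → V p d
  column j M = map (λ row → lookup row j) M

  vadd-identityˡ : (v : V p d) → vadd p d (vzero p d) v ≡ v
  vadd-identityˡ = zipWith-identityˡ +ₘ-identityˡ

  vadd-identityʳ : (v : V p d) → vadd p d v (vzero p d) ≡ v
  vadd-identityʳ = zipWith-identityʳ +ₘ-identityʳ

  power-vadd-p : (v : V p d) → power (vadd p d) (vzero p d) p v ≡ vzero p d
  power-vadd-p {d} v = lookup-ext λ i → begin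
    lookup (power (vadd p d) (vzero p d) p v) i
      ≡⟨ power-homomorphic (λ w → lookup w i) (lookup-replicate i 0ₘ) (lookup-zipWith _+ₘ_ i) p v ⟩
    power _+ₘ_ 0ₘ p (lookup v i)  ≡⟨ power-+ₘ-n (lookup v i) ⟩
    0ₘ                            ≡⟨ lookup-replicate i 0ₘ ⟨
    lookup (vzero p d) i          ∎

  dot-vadd : (u v w : V p d) → dot p d u (vadd p d v w) ≡ dot p d u v +ₘ dot p d u w
  dot-vadd [] [] [] = sym (+ₘ-identityʳ 0ₘ)
  dot-vadd (a ∷ u) (x ∷ v) (y ∷ w) =
    trans (cong₂ _+ₘ_ (*ₘ-distribˡ-+ₘ a x y) (dot-vadd u v w)) (+ₘ-interchange (a *ₘ x) (a *ₘ y) (dot p _ u v) (dot p _ u w))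

  dot-vzero : (u : V p d) → dot p d u (vzero p d) ≡ 0ₘ
  dot-vzero []      = refl
  dot-vzero (a ∷ u) = trans (cong₂ _+ₘ_ (*ₘ-zeroʳ a) (dot-vzero u)) (+ₘ-identityʳ 0ₘ)

  dot-basis : (u : V p d) (j : Fin d) → dot p d u (basis j) ≡ lookup u j
  dot-basis (a ∷ u) fzero    = trans (cong₂ _+ₘ_ (*ₘ-identityʳ a) (dot-vzero u)) (+ₘ-identityʳ a)
  dot-basis (a ∷ u) (fsuc j) = trans (cong₂ _+ₘ_ (*ₘ-zeroʳ a) (dot-basis u j)) (+ₘ-identityˡ (lookup u j))

  lookup-basis : (i j : Fin d) → lookup (basis j) i ≡ (if does (i ≟ j) then 1ₘ else 0ₘ)
  lookup-basis fzero    fzero    = refl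
  lookup-basis fzero    (fsuc j) = refl
  lookup-basis (fsuc i) fzero    = lookup-replicate i 0ₘ
  lookup-basis (fsuc i) (fsuc j) = lookup-basis i j

  mapply-vadd : (M : Mat p d) (v w : V p d) →
                mapply p d M (vadd p d v w) ≡ vadd p d (mapply p d M v) (mapply p d M w)
  mapply-vadd {d} M v w = rows M
    where
    rows : (N : Vec (V p d) m) →
           map (λ row → dot p d row (vadd p d v w)) N
           ≡ vadd p m (map (λ row → dot p d row v) N) (map (λ row → dot p d row w) N)
    rows []      = refl
    rows (u ∷ N) = cong₂ _∷_ (dot-vadd u v w) (rows N)

  mapply-vzero : (M : Mat p d) → mapply p d M (vzero p d) ≡ vzero p d
  mapply-vzero M = trans (map-cong dot-vzero M) (map-const M 0ₘ)

  mapply-basis : (M : Mat p d) (j : Fin d) → mapply p d M (basis j) ≡ column j M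
  mapply-basis M j = map-cong (λ row → dot-basis row j) M

  record IsAdditive (g : V p d → V p d) : Set where
    field
      +-hom : ∀ v w → g (vadd p d v w) ≡ vadd p d (g v) (g w)
      0-hom : g (vzero p d) ≡ vzero p d

  mapply-isAdditive : (M : Mat p d) → IsAdditive (mapply p d M)
  mapply-isAdditive M = record { +-hom = mapply-vadd M ; 0-hom = mapply-vzero M }

  ∘-isAdditive : {g h : V p d → V p d} → IsAdditive g → IsAdditive h → IsAdditive (g ∘ h)
  ∘-isAdditive {g = g} {h} g-add h-add = record
    { +-hom = λ v w → trans (cong g (H.+-hom v w)) (G.+-hom (h v) (h w))
    ; 0-hom = trans (cong g H.0-hom) G.0-hom
    }
    where module G = IsAdditive g-add
          module H = IsAdditive h-add

  -- Scalars are iterated sums of 1ₘ, so every vector is reached from zero by adding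
  -- basis vectors; hence additive maps are F_p-linear.
  data BasisSum : V p d → Set where
    []   : BasisSum (vzero p d)
    _+e_ : {v : V p d} → BasisSum v → (j : Fin d) → BasisSum (vadd p d v (basis j))

  basisSum-0∷ : {v : V p d} → BasisSum v → BasisSum (0ₘ ∷ v)
  basisSum-0∷ [] = []
  basisSum-0∷ {d} (_+e_ {v = v} s j) =
    subst (λ a → BasisSum (a ∷ vadd p d v (basis j))) (+ₘ-identityʳ 0ₘ) (basisSum-0∷ s +e fsuc j)

  basisSum-mod∷ : {v : V p d} → BasisSum v → ∀ x → BasisSum ((x mod p) ∷ v)
  basisSum-mod∷ s zero = basisSum-0∷ s
  basisSum-mod∷ {v = v} s (suc x) =
    subst₂ (λ a w → BasisSum (a ∷ w)) (mod-+ₘ-1ₘ x) (vadd-identityʳ v) (basisSum-mod∷ s x +e fzero)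

  basisSum : (v : V p d) → BasisSum v
  basisSum []      = []
  basisSum (a ∷ v) = subst (λ b → BasisSum (b ∷ v)) (mod-toℕ a) (basisSum-mod∷ (basisSum v) (toℕ a))

  additive-ext : {g h : V p d → V p d} → IsAdditive g → IsAdditive h →
                 (∀ j → g (basis j) ≡ h (basis j)) → ∀ v → g v ≡ h v
  additive-ext {d} {g} {h} g-add h-add agree v = go (basisSum v)
    where
    module G = IsAdditive g-add
    module H = IsAdditive h-add
    go : {v : V p d} → BasisSum v → g v ≡ h v
    go []                 = trans G.0-hom (sym H.0-hom)
    go (_+e_ {v = v} s j) = begin
      g (vadd p d v (basis j))           ≡⟨ G.+-hom v (basis j) ⟩
      vadd p d (g v) (g (basis j))       ≡⟨ cong₂ (vadd p d) (go s) (agree j) ⟩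
      vadd p d (h v) (h (basis j))       ≡⟨ H.+-hom v (basis j) ⟨
      h (vadd p d v (basis j))           ∎

  matrixOf : (V p d → V p d) → Mat p d
  matrixOf g = tabulate λ i → tabulate λ j → lookup (g (basis j)) i

  column-tabulate : (j : Fin d) (F : Fin d → Fin d → Fin p) →
                    column j (tabulate λ i → tabulate (F i)) ≡ tabulate (λ i → F i j)
  column-tabulate j F = lookup-ext λ i →
    trans (lookup-map i _ (tabulate λ i → tabulate (F i)))
          (trans (cong (λ row → lookup row j) (lookup∘tabulate _ i))
                 (trans (lookup∘tabulate (F i) j) (sym (lookup∘tabulate _ i))))

  column-matrixOf : (g : V p d → V p d) (j : Fin d) → column j (matrixOf g) ≡ g (basis j)
  column-matrixOf g j = trans (column-tabulate j _) (tabulate∘lookup (g (basis j)))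

  column-idMat : (j : Fin d) → column j (idMat p d) ≡ basis j
  column-idMat j = trans (column-tabulate j _)
    (lookup-ext λ i → trans (lookup∘tabulate _ i) (sym (lookup-basis i j)))

  matrix-ext-columns : {M N : Mat p d} → (∀ j → column j M ≡ column j N) → M ≡ N
  matrix-ext-columns {M = M} {N} eq = lookup-ext λ i → lookup-ext λ j → begin
    lookup (lookup M i) j   ≡⟨ lookup-map i _ M ⟨
    lookup (column j M) i   ≡⟨ cong (λ c → lookup c i) (eq j) ⟩
    lookup (column j N) i   ≡⟨ lookup-map i _ N ⟩
    lookup (lookup N i) j   ∎

  matrix-ext : {M N : Mat p d} → (∀ v → mapply p d M v ≡ mapply p d N v) → M ≡ N
  matrix-ext {M = M} {N} eq =
    matrix-ext-columns λ j → trans (sym (mapply-basis M j)) (trans (eq (basis j)) (mapply-basis N j))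

  mapply-matrixOf : {g : V p d → V p d} → IsAdditive g → ∀ v → mapply p d (matrixOf g) v ≡ g v
  mapply-matrixOf {g = g} g-add = additive-ext (mapply-isAdditive (matrixOf g)) g-add
    λ j → trans (mapply-basis (matrixOf g) j) (column-matrixOf g j)

  matrixOf-mapply : (M : Mat p d) → matrixOf (mapply p d M) ≡ M
  matrixOf-mapply {d} M = matrix-ext (mapply-matrixOf (mapply-isAdditive M))

  matrixOf-cong : {g h : V p d → V p d} → (∀ v → g v ≡ h v) → matrixOf g ≡ matrixOf h
  matrixOf-cong eq = tabulate-cong λ i → tabulate-cong λ j → cong (λ w → lookup w i) (eq (basis j))

  mapply-idMat : (v : V p d) → mapply p d (idMat p d) v ≡ v
  mapply-idMat {d} = additive-ext (mapply-isAdditive (idMat p d)) (record { +-hom = λ _ _ → refl ; 0-hom = refl })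
    λ j → trans (mapply-basis (idMat p d) j) (column-idMat j)

  mapply-mmul : (M N : Mat p d) (v : V p d) →
                mapply p d (mmul p d M N) v ≡ mapply p d M (mapply p d N v)
  mapply-mmul {d} M N = additive-ext (mapply-isAdditive (mmul p d M N))
    (∘-isAdditive (mapply-isAdditive M) (mapply-isAdditive N)) λ j → begin
      mapply p d (mmul p d M N) (basis j)                  ≡⟨ mapply-basis (mmul p d M N) j ⟩
      column j (mmul p d M N)                              ≡⟨ column-tabulate j _ ⟩
      tabulate (λ i → dot p d (lookup M i) (column j N))   ≡⟨ tabulate-cong (λ i → lookup-map i _ M) ⟨
      tabulate (lookup (mapply p d M (column j N)))        ≡⟨ tabulate∘lookup _ ⟩
      mapply p d M (column j N)                            ≡⟨ cong (mapply p d M) (mapply-basis N j) ⟨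
      mapply p d M (mapply p d N (basis j))                ∎

  mapply-cong-mmul : {M N M′ N′ : Mat p d} → mmul p d M N ≡ mmul p d M′ N′ →
                     ∀ v → mapply p d M (mapply p d N v) ≡ mapply p d M′ (mapply p d N′ v)
  mapply-cong-mmul {d} {M = M} {N} {M′} {N′} eq v = begin
    mapply p d M (mapply p d N v)     ≡⟨ mapply-mmul M N v ⟨
    mapply p d (mmul p d M N) v       ≡⟨ cong (λ P → mapply p d P v) eq ⟩
    mapply p d (mmul p d M′ N′) v     ≡⟨ mapply-mmul M′ N′ v ⟩
    mapply p d M′ (mapply p d N′ v)   ∎

  mapply-inverse : {U T : Mat p d} → mmul p d U T ≡ idMat p d → ∀ v → mapply p d U (mapply p d T v) ≡ v
  mapply-inverse {d} {U = U} {T} UT≡1 v =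
    trans (sym (mapply-mmul U T v)) (trans (cong (λ P → mapply p d P v) UT≡1) (mapply-idMat v))

  matrixOf-inverse : {g h : V p d → V p d} → IsAdditive g → IsAdditive h → (∀ v → g (h v) ≡ v) →
                     mmul p d (matrixOf g) (matrixOf h) ≡ idMat p d
  matrixOf-inverse {d} {g = g} {h} g-add h-add gh≡id = matrix-ext λ v → begin
    mapply p d (mmul p d (matrixOf g) (matrixOf h)) v       ≡⟨ mapply-mmul (matrixOf g) (matrixOf h) v ⟩
    mapply p d (matrixOf g) (mapply p d (matrixOf h) v)     ≡⟨ cong (mapply p d (matrixOf g)) (mapply-matrixOf h-add v) ⟩
    mapply p d (matrixOf g) (h v)                           ≡⟨ mapply-matrixOf g-add (h v) ⟩
    g (h v)                                                 ≡⟨ gh≡id v ⟩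
    v                                                       ≡⟨ mapply-idMat v ⟨
    mapply p d (idMat p d) v                                ∎

  intertwiner-inverse : {T U P Q : Mat p d} → mmul p d T U ≡ idMat p d → mmul p d U T ≡ idMat p d →
                        mmul p d T P ≡ mmul p d Q T → mmul p d U Q ≡ mmul p d P U
  intertwiner-inverse {d} {T = T} {U} {P} {Q} TU≡1 UT≡1 TP≡QT = matrix-ext λ v → begin
    mapply p d (mmul p d U Q) v                            ≡⟨ mapply-mmul U Q v ⟩
    mapply p d U (mapply p d Q v)                          ≡⟨ cong (mapply p d U ∘ mapply p d Q) (mapply-inverse TU≡1 v) ⟨
    mapply p d U (mapply p d Q (mapply p d T (mapply p d U v)))
      ≡⟨ cong (mapply p d U) (mapply-cong-mmul TP≡QT (mapply p d U v)) ⟨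
    mapply p d U (mapply p d T (mapply p d P (mapply p d U v)))  ≡⟨ mapply-inverse UT≡1 _ ⟩
    mapply p d P (mapply p d U v)                          ≡⟨ mapply-mmul P U v ⟨
    mapply p d (mmul p d P U) v                            ∎

module Dihedral (r : ℕ) .{{_ : NonZero r}} where
  open Modular r

  dmul-identityˡ : ∀ y → dmul r (dunit r) y ≡ y
  dmul-identityˡ (k , e) = cong (_, e) (+ₘ-identityˡ k)

  zneg-0ₘ : zneg r 0ₘ ≡ 0ₘ
  zneg-0ₘ = trans (cong (λ z → (r ∸ z) mod r) toℕ-0ₘ) (mod-cong (trans (n%n≡0 r) (sym (m*n%n≡0 0 r))))

  dmul-identityʳ : ∀ y → dmul r y (dunit r) ≡ y
  dmul-identityʳ (k , false) = cong (_, false) (+ₘ-identityʳ k)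
  dmul-identityʳ (k , true)  = cong (_, true) (trans (cong (zadd r k) zneg-0ₘ) (+ₘ-identityʳ k))

  power-rotation : ∀ k c → power (dmul r) (dunit r) k (c , false) ≡ (power _+ₘ_ 0ₘ k c , false)
  power-rotation k c = sym (power-homomorphic (_, false) refl (λ _ _ → refl) k c)

  power-odd-reflection : ∀ q c → proj₂ (power (dmul r) (dunit r) (1 + q * 2) (c , true)) ≡ true
  power-odd-reflection q c = trans (power-homomorphic {_∙_ = _xor_} proj₂ refl (λ _ _ → refl) (1 + q * 2) (c , true)) (odd-power q)
    where
    odd-power : ∀ q → power _xor_ false (1 + q * 2) true ≡ true
    odd-power zero    = refl
    odd-power (suc q) = cong (not ∘ not) (odd-power q)

  no-p-torsion : ∀ {p} → Prime p → ¬ 2 ∣ p → ¬ p ∣ r →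
                 ∀ y → power (dmul r) (dunit r) p y ≡ dunit r → y ≡ dunit r
  no-p-torsion {p} p-prime 2∤p p∤r (c , false) yᵖ≡1 =
    cong (_, false) (power-+ₘ-coprime (Coprime.sym (prime∤⇒coprime p-prime p∤r)) c
      (cong proj₁ (trans (sym (power-rotation p c)) yᵖ≡1)))
  no-p-torsion {p} p-prime 2∤p p∤r (c , true) yᵖ≡1 with odd⇒1+2q p 2∤p
  ... | q , refl with () ← trans (sym (power-odd-reflection q c)) (cong proj₂ yᵖ≡1)

module SemidirectProduct (p d r : ℕ) .{{_ : NonZero p}} .{{_ : NonZero r}}
  (ψ : Rep p d r) (ψ-unit : ψ (dunit r) ≡ idMat p d)
  (no-p-torsion : ∀ y → power (dmul r) (dunit r) p y ≡ dunit r → y ≡ dunit r) where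

  open LinearAlgebra p
  open Dihedral r using (dmul-identityˡ; dmul-identityʳ)

  infixl 7 _·_
  _·_ : G p d r → G p d r → G p d r
  _·_ = gmul p d r ψ

  1G : G p d r
  1G = incD p d r (dunit r)

  inV : V p d → G p d r
  inV v = (v , dunit r)

  act : Dih r → V p d → V p d
  act x = mapply p d (ψ x)

  act-unit : ∀ v → act (dunit r) v ≡ v
  act-unit v = trans (cong (λ M → mapply p d M v) ψ-unit) (mapply-idMat v)

  ·-identityˡ : ∀ a → 1G · a ≡ a
  ·-identityˡ (w , y) = cong₂ _,_ (trans (vadd-identityˡ _) (act-unit w)) (dmul-identityˡ y)

  ·-identityʳ : ∀ a → a · 1G ≡ a
  ·-identityʳ (v , x) = cong₂ _,_ (trans (cong (vadd p d v) (mapply-vzero _)) (vadd-identityʳ v)) (dmul-identityʳ x)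

  inV-· : ∀ v w → inV v · inV w ≡ inV (vadd p d v w)
  inV-· v w = cong₂ _,_ (cong (vadd p d v) (act-unit w)) (dmul-identityˡ (dunit r))

  inV-·-incD : ∀ v x → inV v · incD p d r x ≡ (v , x)
  inV-·-incD v x = cong₂ _,_ (trans (cong (vadd p d v) (mapply-vzero _)) (vadd-identityʳ v)) (dmul-identityˡ x)

  incD-·-inV : ∀ x v → incD p d r x · inV v ≡ (act x v , x)
  incD-·-inV x v = cong₂ _,_ (vadd-identityˡ _) (dmul-identityʳ x)

  inV-power-p : ∀ v → power _·_ 1G p (inV v) ≡ 1G
  inV-power-p v = trans (sym (power-homomorphic inV refl (λ v w → sym (inV-· v w)) p v)) (cong inV (power-vadd-p v))

  module Automorphism {f : G p d r → G p d r} (f-aut : IsAut _·_ f) where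
    open IsAut f-aut

    f-1G : f 1G ≡ 1G
    f-1G = isAut-identity f-aut ·-identityˡ ·-identityʳ

    f-inV-∈V : ∀ v → proj₂ (f (inV v)) ≡ dunit r
    f-inV-∈V v = no-p-torsion _ (begin
      power (dmul r) (dunit r) p (proj₂ (f (inV v)))  ≡⟨ power-homomorphic proj₂ refl (λ _ _ → refl) p (f (inV v)) ⟨
      proj₂ (power _·_ 1G p (f (inV v)))             ≡⟨ cong proj₂ (power-homomorphic f f-1G hom p (inV v)) ⟨
      proj₂ (f (power _·_ 1G p (inV v)))             ≡⟨ cong (proj₂ ∘ f) (inV-power-p v) ⟩
      proj₂ (f 1G)                                   ≡⟨ cong proj₂ f-1G ⟩
      dunit r                                        ∎)

    onV : V p d → V p d
    onV v = proj₁ (f (inV v))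

    f-inV : ∀ v → f (inV v) ≡ inV (onV v)
    f-inV v = cong (onV v ,_) (f-inV-∈V v)

    onV-isAdditive : IsAdditive onV
    onV-isAdditive = record
      { +-hom = λ v w → cong proj₁ (begin
          f (inV (vadd p d v w))       ≡⟨ cong f (inV-· v w) ⟨
          f (inV v · inV w)            ≡⟨ hom (inV v) (inV w) ⟩
          f (inV v) · f (inV w)        ≡⟨ cong₂ _·_ (f-inV v) (f-inV w) ⟩
          inV (onV v) · inV (onV w)    ≡⟨ inV-· (onV v) (onV w) ⟩
          inV (vadd p d (onV v) (onV w)) ∎)
      ; 0-hom = cong proj₁ f-1G
      }

    linearPart : Mat p d
    linearPart = matrixOf onV

    mapply-linearPart : ∀ v → mapply p d linearPart v ≡ onV v
    mapply-linearPart = mapply-matrixOf onV-isAdditive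

    onV-inv-onV : ∀ v → proj₁ (inv (inV (onV v))) ≡ v
    onV-inv-onV v = cong proj₁ (trans (cong inv (sym (f-inV v))) (invˡ (inV v)))

    module _ (f-D : ∀ x → proj₁ (f (incD p d r x)) ≡ vzero p d) where

      f-incD : ∀ x → f (incD p d r x) ≡ incD p d r (κ p d r f x)
      f-incD x = cong (_, κ p d r f x) (f-D x)

      f-pair : ∀ v x → f (v , x) ≡ (onV v , κ p d r f x)
      f-pair v x = begin
        f (v , x)                              ≡⟨ cong f (inV-·-incD v x) ⟨
        f (inV v · incD p d r x)               ≡⟨ hom (inV v) (incD p d r x) ⟩
        f (inV v) · f (incD p d r x)           ≡⟨ cong₂ _·_ (f-inV v) (f-incD x) ⟩
        inV (onV v) · incD p d r (κ p d r f x) ≡⟨ inV-·-incD (onV v) _ ⟩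
        (onV v , κ p d r f x)                  ∎

      onV-act : ∀ x v → onV (act x v) ≡ act (κ p d r f x) (onV v)
      onV-act x v = cong proj₁ (begin
        f (inV (act x v))                      ≡⟨ f-pair (act x v) (dunit r) ⟩
        (onV (act x v) , κ p d r f (dunit r))  ≡⟨ cong (onV (act x v) ,_) (cong proj₂ (f-incD (dunit r))) ⟨
        (onV (act x v) , proj₂ (f 1G))         ≡⟨ cong (onV (act x v) ,_) (cong proj₂ f-1G) ⟩
        inV (onV (act x v))                    ≡⟨ cong (λ v → inV (proj₁ v)) (f-pair (act x v) x) ⟨
        inV (proj₁ (f (act x v , x)))          ≡⟨ cong (inV ∘ proj₁ ∘ f) (incD-·-inV x v) ⟨
        inV (proj₁ (f (incD p d r x · inV v))) ≡⟨ cong (inV ∘ proj₁) (hom (incD p d r x) (inV v)) ⟩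
        inV (proj₁ (f (incD p d r x) · f (inV v)))
          ≡⟨ cong (inV ∘ proj₁) (cong₂ _·_ (f-incD x) (f-inV v)) ⟩
        inV (proj₁ (incD p d r (κ p d r f x) · inV (onV v)))
          ≡⟨ cong (inV ∘ proj₁) (incD-·-inV (κ p d r f x) (onV v)) ⟩
        inV (act (κ p d r f x) (onV v))        ∎)

      linearPart-intertwines : ∀ x → mmul p d linearPart (ψ x) ≡ mmul p d (ψ (κ p d r f x)) linearPart
      linearPart-intertwines x = matrix-ext λ v → begin
        mapply p d (mmul p d linearPart (ψ x)) v               ≡⟨ mapply-mmul linearPart (ψ x) v ⟩
        mapply p d linearPart (act x v)                        ≡⟨ mapply-linearPart (act x v) ⟩
        onV (act x v)                                          ≡⟨ onV-act x v ⟩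
        act (κ p d r f x) (onV v)                              ≡⟨ cong (act (κ p d r f x)) (mapply-linearPart v) ⟨
        act (κ p d r f x) (mapply p d linearPart v)            ≡⟨ mapply-mmul (ψ (κ p d r f x)) linearPart v ⟨
        mapply p d (mmul p d (ψ (κ p d r f x)) linearPart) v   ∎

  open Automorphism using (onV; onV-isAdditive; onV-inv-onV; linearPart; mapply-linearPart; f-pair; linearPart-intertwines)

  linearPart-invertible : {f : G p d r → G p d r} (f-aut : IsAut _·_ f) → Invertible p d r (linearPart f-aut)
  linearPart-invertible f-aut =
    linearPart (inv-isAut f-aut) ,
    matrixOf-inverse (onV-isAdditive f-aut) (onV-isAdditive (inv-isAut f-aut)) (onV-inv-onV (inv-isAut f-aut)) ,
    matrixOf-inverse (onV-isAdditive (inv-isAut f-aut)) (onV-isAdditive f-aut) (onV-inv-onV f-aut)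

  semidirectMap : Mat p d → (Dih r → Dih r) → G p d r → G p d r
  semidirectMap T σ (v , x) = (mapply p d T v , σ x)

  module _ {T : Mat p d} {σ : Dih r → Dih r} (σ-aut : IsAut (dmul r) σ) where
    module σ = IsAut σ-aut

    semidirectMap-isAut : Invertible p d r T → (∀ x → mmul p d T (ψ x) ≡ mmul p d (ψ (σ x)) T) →
                          IsAut _·_ (semidirectMap T σ)
    semidirectMap-isAut (U , TU≡1 , UT≡1) T-int = record
      { inv  = semidirectMap U σ.inv
      ; invˡ = λ (v , x) → cong₂ _,_ (mapply-inverse UT≡1 v) (σ.invˡ x)
      ; invʳ = λ (v , x) → cong₂ _,_ (mapply-inverse TU≡1 v) (σ.invʳ x)
      ; hom  = λ (v , x) (w , y) → cong₂ _,_
          (trans (mapply-vadd T v (act x w)) (cong (vadd p d (mapply p d T v)) (mapply-cong-mmul (T-int x) w)))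
          (σ.hom x y)
      }

    semidirectMap-normalises : InN p d r (semidirectMap T σ)
    semidirectMap-normalises =
      (λ _ → mapply-vzero T) , λ y → σ.inv y , cong₂ _,_ (mapply-vzero T) (σ.invʳ y)

  RepIso-sym : {φ χ : Rep p d r} → RepIso p d r φ χ → RepIso p d r χ φ
  RepIso-sym {φ} {χ} (T , (U , TU≡1 , UT≡1) , T-int) =
    U , (T , UT≡1 , TU≡1) , λ x → intertwiner-inverse {T = T} {U} {φ x} {χ x} TU≡1 UT≡1 (T-int x)

  image≡stabiliser : ImageIsStabiliser p d r ψ
  image≡stabiliser = image⊆stabiliser , stabiliser⊆image
    where
    image⊆stabiliser : ∀ f → IsAut _·_ f → InN p d r f → RepIso p d r (λ x → ψ (κ p d r f x)) ψ
    image⊆stabiliser f f-aut (f-D , _) =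
      RepIso-sym (linearPart f-aut , linearPart-invertible f-aut , linearPart-intertwines f-aut f-D)

    stabiliser⊆image : ∀ σ → IsAut (dmul r) σ → RepIso p d r (λ x → ψ (σ x)) ψ →
                       ∃ λ f → IsAut _·_ f × InN p d r f × (∀ x → κ p d r f x ≡ σ x)
    stabiliser⊆image σ σ-aut ψσ≅ψ with RepIso-sym ψσ≅ψ
    ... | T , T-inv , T-int =
      semidirectMap T σ , semidirectMap-isAut σ-aut T-inv T-int , semidirectMap-normalises σ-aut , λ _ → refl

  kernel≅units : KerIsoUnits p d r ψ
  kernel≅units = record
    { Φ    = toUnit
    ; resp = λ k k′ k≗k′ → matrixOf-cong λ v → cong proj₁ (k≗k′ (inV v))
    ; inj  = inj
    ; surj = surj
    ; hom  = hom
    }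
    where
    toUnit : KerEl p d r ψ → UnitEl p d r ψ
    toUnit (f , f-aut , (f-D , _) , f∣D≡id) =
      linearPart f-aut , linearPart-invertible f-aut ,
      λ x → subst (λ y → mmul p d (linearPart f-aut) (ψ x) ≡ mmul p d (ψ y) (linearPart f-aut))
                  (f∣D≡id x) (linearPart-intertwines f-aut f-D x)

    kernel-pair : ∀ (k : KerEl p d r ψ) v x → proj₁ k (v , x) ≡ (mapply p d (proj₁ (toUnit k)) v , x)
    kernel-pair (f , f-aut , (f-D , _) , f∣D≡id) v x =
      trans (f-pair f-aut f-D v x) (cong₂ _,_ (sym (mapply-linearPart f-aut v)) (f∣D≡id x))

    inj : ∀ k k′ → proj₁ (toUnit k) ≡ proj₁ (toUnit k′) → ∀ a → proj₁ k a ≡ proj₁ k′ a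
    inj k k′ T≡T′ (v , x) =
      trans (kernel-pair k v x) (trans (cong (λ T → (mapply p d T v , x)) T≡T′) (sym (kernel-pair k′ v x)))

    surj : ∀ (u : UnitEl p d r ψ) → ∃ λ (k : KerEl p d r ψ) → proj₁ (toUnit k) ≡ proj₁ u
    surj (T , T-inv , T-comm) =
      (semidirectMap T id , semidirectMap-isAut id-isAut T-inv T-comm , semidirectMap-normalises id-isAut , λ _ → refl) ,
      matrixOf-mapply T

    hom : ∀ k₁ k₂ k₃ → (∀ a → proj₁ k₃ a ≡ proj₁ k₁ (proj₁ k₂ a)) →
          proj₁ (toUnit k₃) ≡ mmul p d (proj₁ (toUnit k₁)) (proj₁ (toUnit k₂))
    hom k₁ k₂ k₃ k₃≗k₁k₂ = matrix-ext λ v → begin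
      mapply p d T₃ v                     ≡⟨ cong proj₁ (kernel-pair k₃ v (dunit r)) ⟨
      proj₁ (proj₁ k₃ (inV v))            ≡⟨ cong proj₁ (k₃≗k₁k₂ (inV v)) ⟩
      proj₁ (proj₁ k₁ (proj₁ k₂ (inV v))) ≡⟨ cong (proj₁ ∘ proj₁ k₁) (kernel-pair k₂ v (dunit r)) ⟩
      proj₁ (proj₁ k₁ (inV (mapply p d T₂ v))) ≡⟨ cong proj₁ (kernel-pair k₁ _ (dunit r)) ⟩
      mapply p d T₁ (mapply p d T₂ v)     ≡⟨ mapply-mmul T₁ T₂ v ⟨
      mapply p d (mmul p d T₁ T₂) v       ∎
      where
      T₁ = proj₁ (toUnit k₁)
      T₂ = proj₁ (toUnit k₂)
      T₃ = proj₁ (toUnit k₃)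

lemma5p3 : (p r d : ℕ) .{{_ : NonZero p}} .{{_ : NonZero r}} →
    Prime p → ¬ (2 ∣ p) → 3 ≤ r → ¬ (p ∣ r) →
    (ψ : Rep p d r) → IsRep p d r ψ → IsIrreducible p d r ψ → NonTrivial p d r ψ →
    KerIsoUnits p d r ψ × ImageIsStabiliser p d r ψ
lemma5p3 p r d p-prime 2∤p _ p∤r ψ (ψ-unit , _) _ _ = kernel≅units , image≡stabiliser
  where open SemidirectProduct p d r ψ ψ-unit (Dihedral.no-p-torsion r p-prime 2∤p p∤r)
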